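{- The complete graph $K_5$ is a penny graph on the flat square torus. That is, there exist five points $p_1,\dots,p_5$ in the flat square torus $T=\mathbb{R}^2/\mathbb{Z}^2$ and a real number $d>0$ such that the toroidal distance between any two distinct points $p_i,p_j$ is at least $d$, and the set of pairs $\{p_i,p_j\}$ at toroidal distance exactly $d$ consists of all $\binom{5}{2}=10$ pairs.
   Context: The flat square torus is $T=\mathbb{R}^2/\mathbb{Z}^2$ with the metric induced from the Euclidean plane: the toroidal distance between the classes of $x,y\in\mathbb{R}^2$ is $\min_{k\in\mathbb{Z}^2}\|x-y-k\|$. A finite graph $G$ is a penny graph on the flat square torus (a toroidal penny graph) if it is isomorphic to the contact graph of a finite family of pairwise non-overlapping congruent closed disks (of some common diameter $d$) on $T$; equivalently, there are points in $T$, one for each vertex, with all pairwise toroidal distances at least $d$, such that two vertices are adjacent exactly when their points are at toroidal distance exactly $d$. -}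

module Defs where

open import Data.Fin using (Fin)
open import Data.Integer using (ℤ)
open import Data.Rational using (ℚ; _+_; _*_; _-_; _≤_; _<_; 0ℚ; _/_)
open import Data.Product using (_×_; Σ; ∃; _,_)
open import Relation.Binary.PropositionalEquality using (_≡_; _≢_)

-- A point of the plane with rational coordinates; it represents its class
-- in the flat square torus T = ℝ² / ℤ².  All predicates below are
-- invariant under translating a representative by an integer vector.
Point : Set
Point = ℚ × ℚ

Lattice : Set
Lattice = ℤ × ℤ

ℤtoℚ : ℤ → ℚ
ℤtoℚ k = k / 1

sqDistShift : Point → Point → Lattice → ℚ
sqDistShift (x₁ , x₂) (y₁ , y₂) (k₁ , k₂) =
  let a = x₁ - y₁ - ℤtoℚ k₁
      b = x₂ - y₂ - ℤtoℚ k₂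
  in a * a + b * b

-- The toroidal distance is min_{k ∈ ℤ²} ‖x - y - k‖.  We work with squared
-- distances D = d² (d > 0), which is equivalent since squaring is strictly
-- monotone on nonnegative reals.
-- "toroidal distance between x and y is at least d"  (D = d²):
TorDistAtLeast : Point → Point → ℚ → Set
TorDistAtLeast x y D = ∀ (k : Lattice) → D ≤ sqDistShift x y k

TorDistExactly : Point → Point → ℚ → Set
TorDistExactly x y D = TorDistAtLeast x y D × ∃ λ (k : Lattice) → sqDistShift x y k ≡ D

K5PennyWitness : (Fin 5 → Point) → ℚ → Set
K5PennyWitness p D =
  (0ℚ < D)
  × (∀ (i j : Fin 5) → i ≢ j → TorDistAtLeast (p i) (p j) D)
  × (∀ (i j : Fin 5) → i ≢ j → TorDistExactly (p i) (p j) D)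

{-# OPTIONS --safe #-}
-- The five centres are the multiples of v = (1/5, 2/5), a subgroup of order 5 of T.  For integers
-- n, k₁, k₂,
--   25 ‖n v − (k₁, k₂)‖² = (n − 5k₁)² + (2n − 5k₂)² = 5 ((n − k₁ − 2k₂)² + (2k₁ − k₂)²),
-- a positive multiple of 5 when 5 ∤ n.  So distinct centres are at squared toroidal distance at
-- least 1/5, and rounding the coordinates of their difference attains 1/5 for every pair.
module Submission where

open import Defs
open import Data.Fin using (Fin)
open import Data.Rational using (ℚ)
open import Data.Product using (Σ; ∃)

open import Data.Empty using (⊥-elim)
open import Data.Fin using (toℕ; _≟_)
open import Data.Fin.Properties using (all?)
open import Data.Product using (_,_)
open import Data.Integer using (ℤ; +_; -[1+_]; +[1+_]; 0ℤ; -_; _-_; _*_; _+_; _≤_; _<_; +≤+; +<+; ∣_∣)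
open import Data.Integer.Properties
  using ( i-j≡0⇒i≡j; abs-*; +-mono-<-≤; *-cancelˡ-<-nonNeg; *-monoˡ-≤-nonNeg; *-monoʳ-≤-nonNeg
        ; i<j⇒suc[i]≤j; module ≤-Reasoning)
open import Data.Integer.Divisibility using (_∣_)
open import Data.Integer.Tactic.RingSolver using (solve-∀)
open import Data.Nat using (z≤n; s≤s)
open import Data.Nat.Divisibility using (divides; _∣?_)
import Data.Nat.Properties as ℕ
import Data.Rational as ℚ
open import Data.Rational.Properties
  using (toℚᵘ-homo-+; toℚᵘ-homo-*; toℚᵘ-homo‿-; toℚᵘ-fromℚᵘ; toℚᵘ-cancel-≤; positive⁻¹)
open import Data.Rational.Unnormalised as ℚᵘ using (mkℚᵘ; *≡*; *≤*)
open import Data.Rational.Unnormalised.Properties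
  using (≤-respʳ-≃; ≃-sym; +-cong; +-congˡ; +-congʳ; *-cong; -‿cong; module ≃-Reasoning)
open import Relation.Binary.PropositionalEquality using (_≡_; _≢_; refl; sym; trans; cong; subst)
open import Relation.Nullary using (¬_)
open import Relation.Nullary.Decidable using (from-yes; ¬?; _→-dec_)

fifths-offset : ∀ x y k → mkℚᵘ x 4 ℚᵘ.- mkℚᵘ y 4 ℚᵘ.- mkℚᵘ k 0 ℚᵘ.≃ mkℚᵘ (x - y - + 5 * k) 4
fifths-offset x y k = *≡* (cross-multiplied x y k)
  where
  cross-multiplied : ∀ x y k →
    ((x * + 5 + (- y) * + 5) * + 1 + (- k) * + 25) * + 5 ≡ (x - y - + 5 * k) * + 25
  cross-multiplied = solve-∀

fifths-sumSq : ∀ x y → mkℚᵘ x 4 ℚᵘ.* mkℚᵘ x 4 ℚᵘ.+ mkℚᵘ y 4 ℚᵘ.* mkℚᵘ y 4 ℚᵘ.≃ mkℚᵘ (x * x + y * y) 24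
fifths-sumSq x y = *≡* (cross-multiplied x y)
  where
  cross-multiplied : ∀ x y → (x * x * + 25 + y * y * + 25) * + 25 ≡ (x * x + y * y) * + 625
  cross-multiplied = solve-∀

-- x / 5 and k / 1 unfold to fromℚᵘ (mkℚᵘ x 4) and fromℚᵘ (mkℚᵘ k 0).
toℚᵘ-fifths-offset : ∀ x y k → ℚ.toℚᵘ (x ℚ./ 5 ℚ.- y ℚ./ 5 ℚ.- ℤtoℚ k) ℚᵘ.≃ mkℚᵘ (x - y - + 5 * k) 4
toℚᵘ-fifths-offset x y k = begin
  ℚ.toℚᵘ ((x ℚ./ 5 ℚ.+ ℚ.- (y ℚ./ 5)) ℚ.+ ℚ.- ℤtoℚ k)
    ≈⟨ toℚᵘ-homo-+ (x ℚ./ 5 ℚ.- y ℚ./ 5) (ℚ.- ℤtoℚ k) ⟩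
  ℚ.toℚᵘ (x ℚ./ 5 ℚ.+ ℚ.- (y ℚ./ 5)) ℚᵘ.+ ℚ.toℚᵘ (ℚ.- ℤtoℚ k)
    ≈⟨ +-cong (toℚᵘ-homo-+ (x ℚ./ 5) (ℚ.- (y ℚ./ 5))) (toℚᵘ-homo‿- (ℤtoℚ k)) ⟩
  (ℚ.toℚᵘ (x ℚ./ 5) ℚᵘ.+ ℚ.toℚᵘ (ℚ.- (y ℚ./ 5))) ℚᵘ.+ ℚᵘ.- ℚ.toℚᵘ (ℤtoℚ k)
    ≈⟨ +-cong (+-cong (toℚᵘ-fromℚᵘ (mkℚᵘ x 4)) (toℚᵘ-homo‿- (y ℚ./ 5)))
              (-‿cong (toℚᵘ-fromℚᵘ (mkℚᵘ k 0))) ⟩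
  (mkℚᵘ x 4 ℚᵘ.+ ℚᵘ.- ℚ.toℚᵘ (y ℚ./ 5)) ℚᵘ.+ ℚᵘ.- mkℚᵘ k 0
    ≈⟨ +-congˡ (ℚᵘ.- mkℚᵘ k 0) (+-congʳ (mkℚᵘ x 4) (-‿cong (toℚᵘ-fromℚᵘ (mkℚᵘ y 4)))) ⟩
  (mkℚᵘ x 4 ℚᵘ.+ ℚᵘ.- mkℚᵘ y 4) ℚᵘ.+ ℚᵘ.- mkℚᵘ k 0
    ≈⟨ fifths-offset x y k ⟩
  mkℚᵘ (x - y - + 5 * k) 4 ∎
  where open ≃-Reasoning

orbit : ℤ → Point
orbit m = m ℚ./ 5 , (+ 2 * m) ℚ./ 5

-- 25 ‖n v − k‖²
scaledSqDist : ℤ → Lattice → ℤ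
scaledSqDist n (k₁ , k₂) = (n - + 5 * k₁) * (n - + 5 * k₁) + (+ 2 * n - + 5 * k₂) * (+ 2 * n - + 5 * k₂)

toℚᵘ-sqDistShift-orbit : ∀ m m' k →
  ℚ.toℚᵘ (sqDistShift (orbit m) (orbit m') k) ℚᵘ.≃ mkℚᵘ (scaledSqDist (m - m') k) 24
toℚᵘ-sqDistShift-orbit m m' (k₁ , k₂) = begin
  ℚ.toℚᵘ (a ℚ.* a ℚ.+ b ℚ.* b)
    ≈⟨ toℚᵘ-homo-+ (a ℚ.* a) (b ℚ.* b) ⟩
  ℚ.toℚᵘ (a ℚ.* a) ℚᵘ.+ ℚ.toℚᵘ (b ℚ.* b)
    ≈⟨ +-cong (toℚᵘ-homo-* a a) (toℚᵘ-homo-* b b) ⟩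
  ℚ.toℚᵘ a ℚᵘ.* ℚ.toℚᵘ a ℚᵘ.+ ℚ.toℚᵘ b ℚᵘ.* ℚ.toℚᵘ b
    ≈⟨ +-cong (*-cong a≃ a≃) (*-cong b≃ b≃) ⟩
  mkℚᵘ x 4 ℚᵘ.* mkℚᵘ x 4 ℚᵘ.+ mkℚᵘ y 4 ℚᵘ.* mkℚᵘ y 4
    ≈⟨ fifths-sumSq x y ⟩
  mkℚᵘ (x * x + y * y) 24
    ≡⟨ cong (λ z → mkℚᵘ (x * x + z * z) 24) (2m-2m'≡2[m-m'] m m' k₂) ⟩
  mkℚᵘ (scaledSqDist (m - m') (k₁ , k₂)) 24 ∎
  where
  open ≃-Reasoning
  a = m ℚ./ 5 ℚ.- m' ℚ./ 5 ℚ.- ℤtoℚ k₁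
  b = (+ 2 * m) ℚ./ 5 ℚ.- (+ 2 * m') ℚ./ 5 ℚ.- ℤtoℚ k₂
  x = m - m' - + 5 * k₁
  y = + 2 * m - + 2 * m' - + 5 * k₂
  a≃ = toℚᵘ-fifths-offset m m' k₁
  b≃ = toℚᵘ-fifths-offset (+ 2 * m) (+ 2 * m') k₂
  2m-2m'≡2[m-m'] : ∀ m m' k → + 2 * m - + 2 * m' - + 5 * k ≡ + 2 * (m - m') - + 5 * k
  2m-2m'≡2[m-m'] = solve-∀

0<x*x : ∀ {x} → x ≢ 0ℤ → 0ℤ < x * x
0<x*x {+ 0} x≢0 = ⊥-elim (x≢0 refl)
0<x*x {+[1+ n ]} _ = +<+ (s≤s z≤n)
0<x*x { -[1+ n ]} _ = +<+ (s≤s z≤n)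

0≤x*x : ∀ x → 0ℤ ≤ x * x
0≤x*x (+ 0) = +≤+ z≤n
0≤x*x +[1+ n ] = +≤+ z≤n
0≤x*x -[1+ n ] = +≤+ z≤n

5∣5*k : ∀ k → + 5 ∣ + 5 * k
5∣5*k k = divides ∣ k ∣ (trans (abs-* (+ 5) k) (ℕ.*-comm 5 ∣ k ∣))

5≤scaledSqDist : ∀ n k → ¬ (+ 5 ∣ n) → + 5 ≤ scaledSqDist n k
5≤scaledSqDist n (k₁ , k₂) 5∤n = begin
  + 5 * + 1                    ≤⟨ *-monoˡ-≤-nonNeg (+ 5) (i<j⇒suc[i]≤j 0<Q) ⟩
  + 5 * Q                      ≡⟨ sym (five-multiple n k₁ k₂) ⟩
  scaledSqDist n (k₁ , k₂)     ∎
  where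
  open ≤-Reasoning
  Q = (n - k₁ - + 2 * k₂) * (n - k₁ - + 2 * k₂) + (+ 2 * k₁ - k₂) * (+ 2 * k₁ - k₂)
  five-multiple : ∀ n k₁ k₂ →
    (n - + 5 * k₁) * (n - + 5 * k₁) + (+ 2 * n - + 5 * k₂) * (+ 2 * n - + 5 * k₂)
      ≡ + 5 * ((n - k₁ - + 2 * k₂) * (n - k₁ - + 2 * k₂) + (+ 2 * k₁ - k₂) * (+ 2 * k₁ - k₂))
  five-multiple = solve-∀
  n-5k₁≢0 : n - + 5 * k₁ ≢ 0ℤ
  n-5k₁≢0 n-5k₁≡0 = 5∤n (subst (+ 5 ∣_) (sym (i-j≡0⇒i≡j n (+ 5 * k₁) n-5k₁≡0)) (5∣5*k k₁))
  0<scaledSqDist : 0ℤ < scaledSqDist n (k₁ , k₂)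
  0<scaledSqDist = +-mono-<-≤ (0<x*x n-5k₁≢0) (0≤x*x (+ 2 * n - + 5 * k₂))
  0<Q : 0ℤ < Q
  0<Q = *-cancelˡ-<-nonNeg (+ 5) (subst (0ℤ <_) (five-multiple n k₁ k₂) 0<scaledSqDist)

orbit-apart : ∀ m m' → ¬ (+ 5 ∣ m - m') → TorDistAtLeast (orbit m) (orbit m') (+ 1 ℚ./ 5)
orbit-apart m m' 5∤m-m' k = toℚᵘ-cancel-≤ (≤-respʳ-≃ (≃-sym (toℚᵘ-sqDistShift-orbit m m' k))
  (*≤* (*-monoʳ-≤-nonNeg (+ 5) (5≤scaledSqDist (m - m') k 5∤m-m'))))

nearestShift : Point → Point → Lattice
nearestShift (x₁ , x₂) (y₁ , y₂) = ℚ.round (x₁ ℚ.- y₁) , ℚ.round (x₂ ℚ.- y₂)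

centres : Fin 5 → Point
centres i = orbit (+ toℕ i)

distinct⇒5∤difference : ∀ (i j : Fin 5) → i ≢ j → ¬ (+ 5 ∣ + toℕ i - + toℕ j)
distinct⇒5∤difference = from-yes (all? λ (i : Fin 5) → all? λ (j : Fin 5) →
  ¬? (i ≟ j) →-dec ¬? (5 ∣? ∣ + toℕ i - + toℕ j ∣))

centres-nearestShift : ∀ (i j : Fin 5) → i ≢ j →
  sqDistShift (centres i) (centres j) (nearestShift (centres i) (centres j)) ≡ + 1 ℚ./ 5
centres-nearestShift = from-yes (all? λ (i : Fin 5) → all? λ (j : Fin 5) →
  ¬? (i ≟ j) →-dec sqDistShift (centres i) (centres j) (nearestShift (centres i) (centres j)) ℚ.≟ + 1 ℚ./ 5)

centres-apart : ∀ (i j : Fin 5) → i ≢ j → TorDistAtLeast (centres i) (centres j) (+ 1 ℚ./ 5)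
centres-apart i j i≢j = orbit-apart (+ toℕ i) (+ toℕ j) (distinct⇒5∤difference i j i≢j)

mainTheorem1 : ∃ λ (p : Fin 5 → Defs.Point) → ∃ λ (D : ℚ) → K5PennyWitness p D
mainTheorem1 = centres , + 1 ℚ./ 5 , positive⁻¹ (+ 1 ℚ./ 5) , centres-apart ,
  λ i j i≢j → centres-apart i j i≢j , nearestShift (centres i) (centres j)
             , centres-nearestShift i j i≢j
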